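{- Let $f,u\in\mathbb{C}$ with $u\neq0$, and consider the planar map $\varphi(d,w)=\big(-d-w^2-f,\ -w-\frac{u}{d+w^2+f}\big)$. Let $(d_n,v_n)_{n\ge0}$ be an orbit of $\varphi$ (i.e. $(d_{n+1},v_{n+1})=\varphi(d_n,v_n)$, with all $d_n\neq0$ and $d_n+v_n^2+f\neq0$). The function $H(d,w)=dw^2-uw+d^2+fd$ is constant on the orbit; define $v$ by $H(d_0,v_0)=-uv$. Then for all $n\ge1$, $$d_{n+1}d_{n-1}=\frac{\alpha d_n+\beta}{d_n^2},\qquad \alpha=u^2,\quad \beta=u^2(v^2+f).$$
   Context: This map arises from the continued fraction expansion on the genus one quartic $Y^2=(X^2+f)^2+4u(X-v)$, where $H=-uv$ is a conserved quantity. -}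

module Defs where

open import Level using (Level; _⊔_) renaming (suc to lsuc)
open import Algebra.Bundles using (CommutativeRing)
open import Relation.Nullary using (¬_)
open import Data.Product using (_×_; _,_; proj₁; proj₂)
open import Data.Nat using (ℕ; suc)

-- A field: a commutative ring with 0 ≠ 1 in which every nonzero element
-- has a multiplicative inverse (given by a total function _⁻¹ whose value
-- at 0 is irrelevant).
record Field (c ℓ : Level) : Set (lsuc (c ⊔ ℓ)) where
  field
    commutativeRing : CommutativeRing c ℓ
  open CommutativeRing commutativeRing public
  field
    _⁻¹        : Carrier → Carrier
    ⁻¹-inverse : ∀ x → ¬ (x ≈ 0#) → x * (x ⁻¹) ≈ 1#
    0≉1        : ¬ (0# ≈ 1#)

module _ {c ℓ : Level} (K : Field c ℓ) where
  open Field K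

  sq : Carrier → Carrier
  sq x = x * x

  φ : (f u : Carrier) → Carrier × Carrier → Carrier × Carrier
  φ f u (d , w) = ((- d) - sq w) - f , (- w) - u * ((d + sq w + f) ⁻¹)

  H : (f u : Carrier) → Carrier → Carrier → Carrier
  H f u d w = (d * sq w) - (u * w) + sq d + f * d

  IsOrbit : (f u : Carrier) → (ℕ → Carrier) → (ℕ → Carrier) → Set ℓ
  IsOrbit f u d v =
    (∀ n → d (suc n) ≈ proj₁ (φ f u (d n , v n)))
    × (∀ n → v (suc n) ≈ proj₂ (φ f u (d n , v n)))
    × (∀ n → ¬ (d n ≈ 0#))
    × (∀ n → ¬ (d n + sq (v n) + f ≈ 0#))

module Submission where

-- Write d₀ , d₁ , d₂ and w₀ , w₁ for consecutive orbit values and g = d₁ + f.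
-- The step of φ is equivalent to the two relations
--   d₀ = -d₁ - w₀² - f        and        u = d₁ (w₀ + w₁),
-- and once u is eliminated this way both H(d₀,w₀) and H(d₁,w₁) become the
-- same polynomial d₁ (g - w₀ w₁); this is why H is conserved.  Moreover
-- d₂ d₀ = (g + w₁²)(g + w₀²) = (g - w₀ w₁)² + g (w₀ + w₁)², and multiplying
-- by d₁² turns the right-hand side into H² + u² (d₁ + f).  Dividing by d₁²
-- and substituting H² = u² v² gives the proposition.

open import Defs
open import Level using (Level)
open import Data.Nat using (ℕ; suc)
open import Relation.Nullary using (¬_)

open import Data.Nat using (zero)
import Data.Nat as ℕ
open import Data.Product using (_×_; _,_; proj₁; proj₂)
open import Data.Product.Properties using (≡-dec)
open import Data.Maybe using (Maybe; map)
open import Relation.Binary.Consequences using (dec⇒weaklyDec)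
open import Relation.Binary.PropositionalEquality as ≡ using (_≡_)
open import Algebra.Bundles using (RawRing; Ring; CommutativeRing)
open import Algebra.Solver.Ring.AlmostCommutativeRing
  using (fromCommutativeRing; _-Raw-AlmostCommutative⟶_)
import Algebra.Solver.Ring as RingSolver
import Algebra.Properties.Semiring.Mult as Multiples
import Algebra.Properties.RingWithoutOne as RingProperties
import Algebra.Properties.AbelianGroup as AbelianGroupProperties
import Algebra.Properties.CommutativeSemigroup as CommutativeSemigroupProperties
import Relation.Binary.Reasoning.Setoid as SetoidReasoning

-- Integers represented by pairs (a , b) standing for a - b, kept in the
-- canonical form where one component is 0.  Canonical forms make equal
-- integer coefficients syntactically equal, which the solver relies on.
module PairIntegers where

  normalise : ℕ → ℕ → ℕ × ℕ
  normalise zero    b       = (0 , b)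
  normalise (suc a) zero    = (suc a , 0)
  normalise (suc a) (suc b) = normalise a b

  rawRing : RawRing _ _
  rawRing = record
    { Carrier = ℕ × ℕ
    ; _≈_     = _≡_
    ; _+_     = λ { (a , b) (c , d) → normalise (a ℕ.+ c) (b ℕ.+ d) }
    ; _*_     = λ { (a , b) (c , d) →
                     normalise (a ℕ.* c ℕ.+ b ℕ.* d) (a ℕ.* d ℕ.+ b ℕ.* c) }
    ; -_      = λ { (a , b) → (b , a) }
    ; 0#      = (0 , 0)
    ; 1#      = (1 , 0)
    }

-- A normalising ring solver valid in every commutative ring: polynomial
-- expressions are interpreted with integer coefficients.
module CommutativeRingSolver {c ℓ : Level} (R : CommutativeRing c ℓ) where
  open CommutativeRing R
  open SetoidReasoning setoid
  open Multiples semiring using (×-homo-+; ×1-homo-*) renaming (_×_ to _·_)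
  open RingProperties (Ring.ringWithoutOne ring) using (x[y-z]≈xy-xz; [y-z]x≈yx-zx)
  open AbelianGroupProperties +-abelianGroup using (⁻¹-∙-comm; ⁻¹-anti-homo‿-)
  open CommutativeSemigroupProperties +-commutativeSemigroup using (interchange)
  open PairIntegers using (normalise)

  sub-interchange : ∀ x y z w → (x + y) - (z + w) ≈ (x - z) + (y - w)
  sub-interchange x y z w = begin
    (x + y) + - (z + w)    ≈⟨ +-congˡ (sym (⁻¹-∙-comm z w)) ⟩
    (x + y) + (- z + - w)  ≈⟨ interchange x y (- z) (- w) ⟩
    (x - z) + (y - w)      ∎

  difference-product : ∀ x y z w → (x - y) * (z - w) ≈ (x * z + y * w) - (x * w + y * z)
  difference-product x y z w = begin
    (x - y) * (z - w)                     ≈⟨ x[y-z]≈xy-xz (x - y) z w ⟩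
    (x - y) * z - (x - y) * w             ≈⟨ +-cong ([y-z]x≈yx-zx z x y) (-‿cong ([y-z]x≈yx-zx w x y)) ⟩
    (x * z - y * z) - (x * w - y * w)     ≈⟨ +-congˡ (⁻¹-anti-homo‿- (x * w) (y * w)) ⟩
    (x * z - y * z) + (y * w - x * w)     ≈⟨ sym (sub-interchange (x * z) (y * w) (y * z) (x * w)) ⟩
    (x * z + y * w) - (y * z + x * w)     ≈⟨ +-congˡ (-‿cong (+-comm (y * z) (x * w))) ⟩
    (x * z + y * w) - (x * w + y * z)     ∎

  ⟦_⟧ᶜ : ℕ × ℕ → Carrier
  ⟦ (a , b) ⟧ᶜ = a · 1# - b · 1#

  ⟦normalise⟧ : ∀ a b → ⟦ normalise a b ⟧ᶜ ≈ a · 1# - b · 1#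
  ⟦normalise⟧ zero    b       = refl
  ⟦normalise⟧ (suc a) zero    = refl
  ⟦normalise⟧ (suc a) (suc b) = begin
    ⟦ normalise a b ⟧ᶜ                    ≈⟨ ⟦normalise⟧ a b ⟩
    a · 1# - b · 1#                      ≈⟨ sym (+-identityˡ _) ⟩
    0# + (a · 1# - b · 1#)               ≈⟨ +-congʳ (sym (-‿inverseʳ 1#)) ⟩
    (1# - 1#) + (a · 1# - b · 1#)        ≈⟨ sym (sub-interchange 1# (a · 1#) 1# (b · 1#)) ⟩
    (1# + a · 1#) - (1# + b · 1#)        ∎

  morphism : PairIntegers.rawRing -Raw-AlmostCommutative⟶ fromCommutativeRing R
  morphism = record
    { ⟦_⟧    = ⟦_⟧ᶜ
    ; +-homo = λ { (a , b) (c , d) → begin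
        ⟦ normalise (a ℕ.+ c) (b ℕ.+ d) ⟧ᶜ          ≈⟨ ⟦normalise⟧ (a ℕ.+ c) (b ℕ.+ d) ⟩
        (a ℕ.+ c) · 1# - (b ℕ.+ d) · 1#            ≈⟨ +-cong (×-homo-+ 1# a c) (-‿cong (×-homo-+ 1# b d)) ⟩
        (a · 1# + c · 1#) - (b · 1# + d · 1#)      ≈⟨ sub-interchange _ _ _ _ ⟩
        ⟦ (a , b) ⟧ᶜ + ⟦ (c , d) ⟧ᶜ                   ∎ }
    ; *-homo = λ { (a , b) (c , d) → begin
        ⟦ normalise (a ℕ.* c ℕ.+ b ℕ.* d) (a ℕ.* d ℕ.+ b ℕ.* c) ⟧ᶜ
            ≈⟨ ⟦normalise⟧ (a ℕ.* c ℕ.+ b ℕ.* d) (a ℕ.* d ℕ.+ b ℕ.* c) ⟩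
        (a ℕ.* c ℕ.+ b ℕ.* d) · 1# - (a ℕ.* d ℕ.+ b ℕ.* c) · 1#
            ≈⟨ +-cong (trans (×-homo-+ 1# (a ℕ.* c) (b ℕ.* d)) (+-cong (×1-homo-* a c) (×1-homo-* b d)))
                      (-‿cong (trans (×-homo-+ 1# (a ℕ.* d) (b ℕ.* c)) (+-cong (×1-homo-* a d) (×1-homo-* b c)))) ⟩
        (a · 1# * c · 1# + b · 1# * d · 1#) - (a · 1# * d · 1# + b · 1# * c · 1#)
            ≈⟨ sym (difference-product _ _ _ _) ⟩
        ⟦ (a , b) ⟧ᶜ * ⟦ (c , d) ⟧ᶜ ∎ }
    ; -‿homo = λ { (a , b) → sym (⁻¹-anti-homo‿- (a · 1#) (b · 1#)) }
    ; 0-homo = -‿inverseʳ 0#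
    ; 1-homo = trans (+-assoc 1# 0# (- 0#)) (trans (+-congˡ (-‿inverseʳ 0#)) (+-identityʳ 1#))
    }

  -- Equal canonical pairs have equal values; the solver uses this to drop zero terms.
  equal-coefficients? : ∀ x y → Maybe (⟦ x ⟧ᶜ ≈ ⟦ y ⟧ᶜ)
  equal-coefficients? x y =
    map (λ { ≡.refl → refl }) (dec⇒weaklyDec (≡-dec ℕ._≟_ ℕ._≟_) x y)

  open RingSolver PairIntegers.rawRing (fromCommutativeRing R) morphism equal-coefficients? public

module Dynamics {c ℓ : Level} (K : Field c ℓ) where
  open Field K
  open SetoidReasoning setoid
  open CommutativeRingSolver commutativeRing using (solve; _:=_; _:+_; _:*_; :-_; _:-_)

  cancel-inverse : ∀ {s} x → ¬ (s ≈ 0#) → s * (x * s ⁻¹) ≈ x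
  cancel-inverse {s} x s≉0 = begin
    s * (x * s ⁻¹)   ≈⟨ *-congˡ (*-comm x (s ⁻¹)) ⟩
    s * (s ⁻¹ * x)   ≈⟨ sym (*-assoc s (s ⁻¹) x) ⟩
    (s * s ⁻¹) * x   ≈⟨ *-congʳ (⁻¹-inverse s s≉0) ⟩
    1# * x           ≈⟨ *-identityˡ x ⟩
    x                ∎

  no-zero-divisors : ∀ {x y} → ¬ (x ≈ 0#) → x * y ≈ 0# → y ≈ 0#
  no-zero-divisors {x} {y} x≉0 xy≈0 = begin
    y                  ≈⟨ sym (cancel-inverse y x≉0) ⟩
    x * (y * x ⁻¹)     ≈⟨ sym (*-assoc x y (x ⁻¹)) ⟩
    (x * y) * x ⁻¹     ≈⟨ *-congʳ xy≈0 ⟩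
    0# * x ⁻¹          ≈⟨ zeroˡ (x ⁻¹) ⟩
    0#                 ∎

  square-nonzero : ∀ {x} → ¬ (x ≈ 0#) → ¬ (sq K x ≈ 0#)
  square-nonzero x≉0 xx≈0 = x≉0 (no-zero-divisors x≉0 xx≈0)

  divide : ∀ {a b x} → ¬ (x ≈ 0#) → a * x ≈ b → a ≈ b * x ⁻¹
  divide {a} {b} {x} x≉0 ax≈b = begin
    a                  ≈⟨ sym (*-identityʳ a) ⟩
    a * 1#             ≈⟨ *-congˡ (sym (⁻¹-inverse x x≉0)) ⟩
    a * (x * x ⁻¹)     ≈⟨ sym (*-assoc a x (x ⁻¹)) ⟩
    (a * x) * x ⁻¹     ≈⟨ *-congʳ ax≈b ⟩
    b * x ⁻¹           ∎

  H-cong : ∀ f {u u′ d d′ w w′} → u ≈ u′ → d ≈ d′ → w ≈ w′ →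
           H K f u d w ≈ H K f u′ d′ w′
  H-cong f u≈ d≈ w≈ =
    +-cong (+-cong (+-cong (*-cong d≈ (*-cong w≈ w≈)) (-‿cong (*-cong u≈ w≈)))
                   (*-cong d≈ d≈))
           (*-congˡ d≈)

  step-reversal : ∀ {x y} a b → y ≈ ((- x) - a) - b → x ≈ ((- y) - a) - b
  step-reversal {x} {y} a b y≈ = begin
    x                                ≈⟨ involution x a b ⟩
    ((- (((- x) - a) - b)) - a) - b  ≈⟨ +-congʳ (+-congʳ (-‿cong (sym y≈))) ⟩
    ((- y) - a) - b                  ∎
    where
    involution : ∀ x a b → x ≈ ((- (((- x) - a) - b)) - a) - b
    involution = solve 3 (λ x a b → x := ((:- (((:- x) :- a) :- b)) :- a) :- b) refl

  -- The common value of H before and after a step, once the step is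
  -- written as d₀ = -d₁ - w₀² - f and u = d₁ (w₀ + w₁).
  conserved-form : (f d₁ w₀ w₁ : Carrier) → Carrier
  conserved-form f d₁ w₀ w₁ = d₁ * ((d₁ + f) - w₀ * w₁)

  H-before-step : ∀ f d₁ w₀ w₁ →
    H K f (d₁ * (w₀ + w₁)) (((- d₁) - sq K w₀) - f) w₀ ≈ conserved-form f d₁ w₀ w₁
  H-before-step = solve 4 (λ f d₁ w₀ w₁ →
    let d₀ = ((:- d₁) :- w₀ :* w₀) :- f ; u = d₁ :* (w₀ :+ w₁) in
    (d₀ :* (w₀ :* w₀)) :- u :* w₀ :+ d₀ :* d₀ :+ f :* d₀
      := d₁ :* ((d₁ :+ f) :- w₀ :* w₁)) refl

  H-after-step : ∀ f d₁ w₀ w₁ →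
    H K f (d₁ * (w₀ + w₁)) d₁ w₁ ≈ conserved-form f d₁ w₀ w₁
  H-after-step = solve 4 (λ f d₁ w₀ w₁ →
    let u = d₁ :* (w₀ :+ w₁) in
    (d₁ :* (w₁ :* w₁)) :- u :* w₁ :+ d₁ :* d₁ :+ f :* d₁
      := d₁ :* ((d₁ :+ f) :- w₀ :* w₁)) refl

  -- With g = d₁ + f the heart of the proposition is
  --   (g + w₁²)(g + w₀²) = (g - w₀ w₁)² + g (w₀ + w₁)²;
  -- multiplied by d₁² it expresses d₂ d₀ d₁² through u and H.
  product-identity : ∀ f d₁ w₀ w₁ →
    let u = d₁ * (w₀ + w₁) ; h = conserved-form f d₁ w₀ w₁ in
    ((((- d₁) - sq K w₁) - f) * (((- d₁) - sq K w₀) - f)) * sq K d₁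
      ≈ sq K u * d₁ + (sq K h + sq K u * f)
  product-identity = solve 4 (λ f d₁ w₀ w₁ →
    let u = d₁ :* (w₀ :+ w₁) ; h = d₁ :* ((d₁ :+ f) :- w₀ :* w₁) in
    ((((:- d₁) :- w₁ :* w₁) :- f) :* (((:- d₁) :- w₀ :* w₀) :- f)) :* (d₁ :* d₁)
      := (u :* u) :* d₁ :+ (h :* h :+ (u :* u) :* f)) refl

  -- After substituting the step, w₀ + w₁ = -u/s with s = d₀ + w₀² + f = -d₁.
  factor-step : ∀ f d₀ w₀ a →
    (((- d₀) - sq K w₀) - f) * (w₀ + ((- w₀) - a)) ≈ (d₀ + sq K w₀ + f) * a
  factor-step = solve 4 (λ f d₀ w₀ a →
    (((:- d₀) :- w₀ :* w₀) :- f) :* (w₀ :+ ((:- w₀) :- a))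
      := (d₀ :+ w₀ :* w₀ :+ f) :* a) refl

  square-of-H : ∀ u v f → sq K (- (u * v)) + sq K u * f ≈ sq K u * (sq K v + f)
  square-of-H = solve 3 (λ u v f →
    (:- (u :* v)) :* (:- (u :* v)) :+ (u :* u) :* f := (u :* u) :* (v :* v :+ f)) refl

  module Orbit (f u : Carrier) (d v : ℕ → Carrier) (orbit : IsOrbit K f u d v) where
    step-d : ∀ n → d (suc n) ≈ ((- d n) - sq K (v n)) - f
    step-d = proj₁ orbit

    step-v : ∀ n → v (suc n) ≈ (- v n) - u * ((d n + sq K (v n) + f) ⁻¹)
    step-v = proj₁ (proj₂ orbit)

    d-nonzero : ∀ n → ¬ (d n ≈ 0#)
    d-nonzero = proj₁ (proj₂ (proj₂ orbit))

    denominator-nonzero : ∀ n → ¬ (d n + sq K (v n) + f ≈ 0#)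
    denominator-nonzero = proj₂ (proj₂ (proj₂ orbit))

    previous : ∀ n → d n ≈ ((- d (suc n)) - sq K (v n)) - f
    previous n = step-reversal (sq K (v n)) f (step-d n)

    u-factorisation : ∀ n → u ≈ d (suc n) * (v n + v (suc n))
    u-factorisation n = sym (begin
      d (suc n) * (v n + v (suc n))                     ≈⟨ *-cong (step-d n) (+-congˡ (step-v n)) ⟩
      (((- d n) - sq K (v n)) - f) * (v n + ((- v n) - u * s ⁻¹))
                                                        ≈⟨ factor-step f (d n) (v n) (u * s ⁻¹) ⟩
      s * (u * s ⁻¹)                                    ≈⟨ cancel-inverse u (denominator-nonzero n) ⟩
      u                                                 ∎)
      where s = d n + sq K (v n) + f

    conserved : ℕ → Carrier
    conserved n = conserved-form f (d (suc n)) (v n) (v (suc n))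

    H-before : ∀ n → H K f u (d n) (v n) ≈ conserved n
    H-before n = trans (H-cong f (u-factorisation n) (previous n) refl)
                       (H-before-step f (d (suc n)) (v n) (v (suc n)))

    H-after : ∀ n → H K f u (d (suc n)) (v (suc n)) ≈ conserved n
    H-after n = trans (H-cong f (u-factorisation n) refl refl)
                      (H-after-step f (d (suc n)) (v n) (v (suc n)))

    H-conserved : ∀ n → H K f u (d n) (v n) ≈ H K f u (d 0) (v 0)
    H-conserved zero    = refl
    H-conserved (suc n) = trans (trans (H-after n) (sym (H-before n))) (H-conserved n)

    product-formula : ∀ n →
      (d (suc (suc n)) * d n) * sq K (d (suc n))
        ≈ sq K u * d (suc n) + (sq K (H K f u (d n) (v n)) + sq K u * f)
    product-formula n = begin
      (d (suc (suc n)) * d n) * sq K d₁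
        ≈⟨ *-congʳ (*-cong (step-d (suc n)) (previous n)) ⟩
      ((((- d₁) - sq K w₁) - f) * (((- d₁) - sq K w₀) - f)) * sq K d₁
        ≈⟨ product-identity f d₁ w₀ w₁ ⟩
      sq K u′ * d₁ + (sq K (conserved n) + sq K u′ * f)
        ≈⟨ +-cong (*-congʳ (square u′≈u)) (+-cong (square (sym (H-before n))) (*-congʳ (square u′≈u))) ⟩
      sq K u * d₁ + (sq K (H K f u (d n) (v n)) + sq K u * f) ∎
      where
      d₁ = d (suc n) ; w₀ = v n ; w₁ = v (suc n) ; u′ = d₁ * (w₀ + w₁)
      u′≈u = sym (u-factorisation n)
      square : ∀ {x y} → x ≈ y → sq K x ≈ sq K y
      square x≈y = *-cong x≈y x≈y

proposition5p1 : {c ℓ : Level} (K : Field c ℓ) → let open Field K in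
    (f u : Carrier) → ¬ (u ≈ 0#) →
    (d v : ℕ → Carrier) → IsOrbit K f u d v →
    (vv : Carrier) → H K f u (d 0) (v 0) ≈ - (u * vv) →
    (m : ℕ) →
      d (suc (suc m)) * d m
        ≈ ((sq K u * d (suc m)) + (sq K u * (sq K vv + f))) * ((sq K (d (suc m))) ⁻¹)
proposition5p1 K f u _ d v orbit vv H₀ m =
  divide (square-nonzero (d-nonzero (suc m))) (begin
    (d (suc (suc m)) * d m) * sq K (d (suc m))
      ≈⟨ product-formula m ⟩
    sq K u * d (suc m) + (sq K (H K f u (d m) (v m)) + sq K u * f)
      ≈⟨ +-congˡ (+-congʳ (*-cong H≈ H≈)) ⟩
    sq K u * d (suc m) + (sq K (- (u * vv)) + sq K u * f)
      ≈⟨ +-congˡ (square-of-H u vv f) ⟩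
    sq K u * d (suc m) + sq K u * (sq K vv + f) ∎)
  where
  open Field K
  open SetoidReasoning setoid
  open Dynamics K
  open Orbit f u d v orbit
  H≈ : H K f u (d m) (v m) ≈ - (u * vv)
  H≈ = trans (H-conserved m) H₀
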